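{- Let $F$ and $G$ be ordered labeled forests and let $S$ be any strategy for $(F,G)$. Then for every vertex $v\in F$ and every vertex $w\in G$, the pair $(F_v - v,\ G_w - w)$ is a relevant subproblem of $S$ on $(F,G)$.
   Context: Forests are finite ordered forests with vertex labels; $\emptyset$ is the empty forest. For a forest $F$ and $v\in F$: $F_v$ is the subtree rooted at $v$, and $F-v$ is the forest obtained by deleting $v$ (its children take its place, in order). $L_F,R_F$ denote the leftmost and rightmost trees of $F$, with roots $\ell_F,r_F$; $F-L_F$ and $F-R_F$ denote $F$ with that entire tree removed. A subforest of $F$ is any forest obtained from $F$ by a sequence of deletions of the leftmost or rightmost root. A strategy for $(F,G)$ is a map $S$ from pairs $(F',G')$ of subforests of $F$ and of $G$ to $\{\mathsf{left},\mathsf{right}\}$. The set of relevant subproblems of $S$ on $(F,G)$ is the smallest set $P$ of pairs of subforests with $(F,G)\in P$ and closed under: for $(F',G')\in P$ with $S(F',G')=\mathsf{right}$, $(F'-r_{F'},G')\in P$ if $F'\neq\emptyset$, $(F',G'-r_{G'})\in P$ if $G'\ne\emptyset$, and if both are nonempty also $(R_{F'}-r_{F'},R_{G'}-r_{G'})\in P$ and $(F'-R_{F'},G'-R_{G'})\in P$; and the same with $\ell, L$ (leftmost) in place of $r, R$ when $S(F',G')=\mathsf{left}$. -}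

module Defs where

open import Data.List using (List; []; _∷_; _++_; _∷ʳ_)
open import Relation.Binary.PropositionalEquality using (_≡_)

data Tree (A : Set) : Set where
  node : A → List (Tree A) → Tree A

Forest : Set → Set
Forest A = List (Tree A)

mutual
  data VertT {A : Set} : Tree A → Set where
    root  : ∀ {a cs} → VertT (node a cs)
    below : ∀ {a cs} → VertF cs → VertT (node a cs)

  data VertF {A : Set} : Forest A → Set where
    here  : ∀ {t ts} → VertT t → VertF (t ∷ ts)
    there : ∀ {t ts} → VertF ts → VertF (t ∷ ts)

mutual
  subtreeT : ∀ {A} (t : Tree A) → VertT t → Tree A
  subtreeT t root = t
  subtreeT (node a cs) (below v) = subtreeF cs v

  subtreeF : ∀ {A} (F : Forest A) → VertF F → Tree A
  subtreeF (t ∷ ts) (here v) = subtreeT t v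
  subtreeF (t ∷ ts) (there v) = subtreeF ts v

rootDel : ∀ {A} → Tree A → Forest A
rootDel (node a cs) = cs

subMinus : ∀ {A} (F : Forest A) → VertF F → Forest A
subMinus F v = rootDel (subtreeF F v)

data Dir : Set where
  left right : Dir

-- A strategy: assigns a direction to each pair of forests
-- (in particular to each pair of subforests of F and G).
Strategy : Set → Set
Strategy A = Forest A → Forest A → Dir

-- A nonempty forest with
-- rightmost tree R = node a cs is written  xs ∷ʳ node a cs ; then
-- F - r_F = xs ++ cs, R_F - r_F = cs, F - R_F = xs.  Symmetrically for left.
data Relevant {A : Set} (S : Strategy A) (F G : Forest A)
       : Forest A → Forest A → Set where
  start : Relevant S F G F G
  rDelF : ∀ {xs a cs G'} → Relevant S F G (xs ∷ʳ node a cs) G' →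
          S (xs ∷ʳ node a cs) G' ≡ right → Relevant S F G (xs ++ cs) G'
  rDelG : ∀ {F' ys b ds} → Relevant S F G F' (ys ∷ʳ node b ds) →
          S F' (ys ∷ʳ node b ds) ≡ right → Relevant S F G F' (ys ++ ds)
  rSub  : ∀ {xs a cs ys b ds} →
          Relevant S F G (xs ∷ʳ node a cs) (ys ∷ʳ node b ds) →
          S (xs ∷ʳ node a cs) (ys ∷ʳ node b ds) ≡ right → Relevant S F G cs ds
  rRest : ∀ {xs a cs ys b ds} →
          Relevant S F G (xs ∷ʳ node a cs) (ys ∷ʳ node b ds) →
          S (xs ∷ʳ node a cs) (ys ∷ʳ node b ds) ≡ right → Relevant S F G xs ys
  lDelF : ∀ {xs a cs G'} → Relevant S F G (node a cs ∷ xs) G' →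
          S (node a cs ∷ xs) G' ≡ left → Relevant S F G (cs ++ xs) G'
  lDelG : ∀ {F' ys b ds} → Relevant S F G F' (node b ds ∷ ys) →
          S F' (node b ds ∷ ys) ≡ left → Relevant S F G F' (ds ++ ys)
  lSub  : ∀ {xs a cs ys b ds} →
          Relevant S F G (node a cs ∷ xs) (node b ds ∷ ys) →
          S (node a cs ∷ xs) (node b ds ∷ ys) ≡ left → Relevant S F G cs ds
  lRest : ∀ {xs a cs ys b ds} →
          Relevant S F G (node a cs ∷ xs) (node b ds ∷ ys) →
          S (node a cs ∷ xs) (node b ds ∷ ys) ≡ left → Relevant S F G xs ys

module Submission where

open import Defs
open import Data.List using ([]; _∷_; [_]; _++_; _∷ʳ_; _∷ʳ′_; initLast)
open import Data.Nat using (ℕ; suc; _+_; _<_; s≤s)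
open import Data.Nat.Induction using (<-wellFounded)
open import Data.Nat.Properties
  using (+-assoc; m≤m+n; n<1+n; +-monoˡ-<; +-monoʳ-<)
open import Data.Product using (Σ-syntax; _,_)
open import Induction.WellFounded using (Acc; acc)
open import Relation.Binary.PropositionalEquality
  using (_≡_; refl; cong; subst; subst₂; sym; trans)

-- Induction on the total size of a relevant pair (F′, G′), with d = S F′ G′.  If v is not the d-most root of F′, it survives
-- with the same subtree in F′ minus that root, a smaller relevant pair;
-- likewise for w.  If v and w are both the d-most roots, then
-- (F′_v − v, G′_w − w) is exactly the subtree subproblem produced by the rules.

module _ {A : Set} where

  size : Forest A → ℕ
  size [] = 0
  size (node a cs ∷ ts) = suc (size cs + size ts)

  size-++ : (xs ys : Forest A) → size (xs ++ ys) ≡ size xs + size ys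
  size-++ [] ys = refl
  size-++ (node a cs ∷ xs) ys =
    cong suc (trans (cong (size cs +_) (size-++ xs ys)) (sym (+-assoc (size cs) (size xs) (size ys))))

  injectˡ : ∀ {xs : Forest A} ys → VertF xs → VertF (xs ++ ys)
  injectˡ ys (here u)  = here u
  injectˡ ys (there v) = there (injectˡ ys v)

  injectʳ : ∀ xs {ys : Forest A} → VertF ys → VertF (xs ++ ys)
  injectʳ []       v = v
  injectʳ (t ∷ xs) v = there (injectʳ xs v)

  subtree-injectˡ : ∀ {xs : Forest A} ys (v : VertF xs) → subtreeF (xs ++ ys) (injectˡ ys v) ≡ subtreeF xs v
  subtree-injectˡ ys (here u)  = refl
  subtree-injectˡ ys (there v) = subtree-injectˡ ys v

  subtree-injectʳ : ∀ xs {ys : Forest A} (v : VertF ys) → subtreeF (xs ++ ys) (injectʳ xs v) ≡ subtreeF ys v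
  subtree-injectʳ []       v = refl
  subtree-injectʳ (t ∷ xs) v = subtree-injectʳ xs v

  data DeleteRoot : Dir → Forest A → Forest A → Forest A → Set where
    rightmost : ∀ xs a cs → DeleteRoot right (xs ∷ʳ node a cs) cs (xs ++ cs)
    leftmost  : ∀ xs a cs → DeleteRoot left  (node a cs ∷ xs) cs (cs ++ xs)

  deleteRoot : ∀ d F → VertF F → Σ[ cs ∈ Forest A ] Σ[ F⁻ ∈ Forest A ] DeleteRoot d F cs F⁻
  deleteRoot left (node a cs ∷ xs) _ = cs , cs ++ xs , leftmost xs a cs
  deleteRoot right F v with initLast F
  deleteRoot right .[] () | []
  ... | xs ∷ʳ′ node a cs = cs , xs ++ cs , rightmost xs a cs

  size-deleteRoot : ∀ {d F cs F⁻} → DeleteRoot d F cs F⁻ → size F⁻ < size F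
  size-deleteRoot (rightmost xs a cs) = begin-strict
      size (xs ++ cs)                 ≡⟨ size-++ xs cs ⟩
      size xs + size cs               <⟨ +-monoʳ-< (size xs) (s≤s (m≤m+n (size cs) 0)) ⟩
      size xs + size [ node a cs ]    ≡⟨ sym (size-++ xs [ node a cs ]) ⟩
      size (xs ∷ʳ node a cs)          ∎
    where open Data.Nat.Properties.≤-Reasoning
  size-deleteRoot (leftmost xs a cs) rewrite size-++ cs xs = n<1+n (size cs + size xs)

  data AfterDeletion {F} (cs F⁻ : Forest A) (v : VertF F) : Set where
    deleted : subMinus F v ≡ cs → AfterDeletion cs F⁻ v
    kept    : (v⁻ : VertF F⁻) → subtreeF F⁻ v⁻ ≡ subtreeF F v → AfterDeletion cs F⁻ v

  afterDeletion : ∀ {d F cs F⁻} → DeleteRoot d F cs F⁻ → (v : VertF F) → AfterDeletion cs F⁻ v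
  afterDeletion (rightmost [] a cs) (here root)      = deleted refl
  afterDeletion (rightmost [] a cs) (here (below u)) = kept u refl
  afterDeletion (rightmost (t ∷ xs) a cs) (here u)   = kept (here u) refl
  afterDeletion (rightmost (t ∷ xs) a cs) (there v) with afterDeletion (rightmost xs a cs) v
  ... | deleted p = deleted p
  ... | kept v⁻ p = kept (there v⁻) p
  afterDeletion (leftmost xs a cs) (here root)      = deleted refl
  afterDeletion (leftmost xs a cs) (here (below u)) = kept (injectˡ xs u) (subtree-injectˡ xs u)
  afterDeletion (leftmost xs a cs) (there v)        = kept (injectʳ cs v) (subtree-injectʳ cs v)

  module _ {F G : Forest A} {S : Strategy A} where

    Relevant-deleteRootˡ : ∀ {F′ G′ d cs F⁻} → Relevant S F G F′ G′ → S F′ G′ ≡ d →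
      DeleteRoot d F′ cs F⁻ → Relevant S F G F⁻ G′
    Relevant-deleteRootˡ r eq (rightmost xs a cs) = rDelF r eq
    Relevant-deleteRootˡ r eq (leftmost xs a cs)  = lDelF r eq

    Relevant-deleteRootʳ : ∀ {F′ G′ d ds G⁻} → Relevant S F G F′ G′ → S F′ G′ ≡ d →
      DeleteRoot d G′ ds G⁻ → Relevant S F G F′ G⁻
    Relevant-deleteRootʳ r eq (rightmost ys b ds) = rDelG r eq
    Relevant-deleteRootʳ r eq (leftmost ys b ds)  = lDelG r eq

    Relevant-children : ∀ {F′ G′ d cs ds F⁻ G⁻} → Relevant S F G F′ G′ → S F′ G′ ≡ d →
      DeleteRoot d F′ cs F⁻ → DeleteRoot d G′ ds G⁻ → Relevant S F G cs ds
    Relevant-children r eq (rightmost xs a cs) (rightmost ys b ds) = rSub r eq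
    Relevant-children r eq (leftmost xs a cs)  (leftmost ys b ds)  = lSub r eq

    Relevant-subMinus : ∀ {F′ G′} → Acc _<_ (size F′ + size G′) → Relevant S F G F′ G′ →
      (v : VertF F′) (w : VertF G′) → Relevant S F G (subMinus F′ v) (subMinus G′ w)
    Relevant-subMinus {F′} {G′} (acc rec) r v w
      with deleteRoot (S F′ G′) F′ v | deleteRoot (S F′ G′) G′ w
    ... | cs , F⁻ , δ | ds , G⁻ , ε with afterDeletion δ v | afterDeletion ε w
    ... | kept v⁻ p | _ =
      subst (λ t → Relevant S F G (rootDel t) _) p
        (Relevant-subMinus (rec (+-monoˡ-< (size G′) (size-deleteRoot δ)))
          (Relevant-deleteRootˡ r refl δ) v⁻ w)
    ... | deleted p | kept w⁻ q =
      subst (λ t → Relevant S F G _ (rootDel t)) q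
        (Relevant-subMinus (rec (+-monoʳ-< (size F′) (size-deleteRoot ε)))
          (Relevant-deleteRootʳ r refl ε) v w⁻)
    ... | deleted p | deleted q = subst₂ (Relevant S F G) (sym p) (sym q) (Relevant-children r refl δ ε)

lemma3 : {A : Set} (F G : Forest A) (S : Strategy A) →
    (v : VertF F) (w : VertF G) →
    Relevant S F G (subMinus F v) (subMinus G w)
lemma3 F G S = Relevant-subMinus (<-wellFounded (size F + size G)) start
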